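{- Let $n$ and $k$ be integers with $1 \le k \le n-1$, and let $x_1, \dots, x_n$ be real numbers. Suppose that for every subset $U \subseteq \{1,\dots,n\}$ with $|U| > k$ we have $\sum_{i \in U} x_i < 0$. Then the number of subsets $U \subseteq \{1,\dots,n\}$ (including the empty set) with $\sum_{i\in U} x_i \ge 0$ is at most $$\binom{n-1}{k-1} + \binom{n-1}{k-2} + \cdots + \binom{n-1}{0} + 1.$$
   Context: Subsets of the sequence are identified with subsets of the index set $\{1,\dots,n\}$; the empty set has sum $0$ and so counts as a subset with nonnegative sum. -}

module Defs where

open import Level using (Level; _⊔_)
open import Data.Bool using (true; false)
open import Data.Nat using (ℕ; _∸_) renaming (_+_ to _+ℕ_)
open import Data.Nat.Combinatorics using (_C_)
open import Data.List using (List; map; upTo)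
open import Data.Nat.ListAction using (sum)
open import Data.Fin using (Fin; zero; suc)
open import Data.Vec using ([]; _∷_)
open import Data.Fin.Subset using (Subset)
open import Data.Product using (∃)
open import Function using (_∘_)
open import Algebra.Bundles using (CommutativeRing)
open import Relation.Binary.Structures using (IsTotalOrder)
open import Relation.Nullary using (¬_)

-- An ordered field (the real numbers are an instance).
record OrderedField (c ℓ₁ ℓ₂ : Level) : Set (Level.suc (c ⊔ ℓ₁ ⊔ ℓ₂)) where
  field
    commRing : CommutativeRing c ℓ₁
  open CommutativeRing commRing public using (Carrier; _≈_; _+_; _*_; 0#; 1#)
  field
    _≤_            : Carrier → Carrier → Set ℓ₂
    isTotalOrder   : IsTotalOrder _≈_ _≤_
    nontrivial     : ¬ (0# ≈ 1#)
    inverse        : ∀ x → ¬ (x ≈ 0#) → ∃ λ y → (x * y) ≈ 1#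
    +-mono-≤       : ∀ {x y} z → x ≤ y → (x + z) ≤ (y + z)
    *-nonneg       : ∀ {x y} → 0# ≤ x → 0# ≤ y → 0# ≤ (x * y)

  _<_ : Carrier → Carrier → Set (ℓ₁ ⊔ ℓ₂)
  x < y = (x ≤ y) Data.Product.× ¬ (x ≈ y)

  subsetSum : ∀ {n} → (Fin n → Carrier) → Subset n → Carrier
  subsetSum x []          = 0#
  subsetSum x (true ∷ U)  = x zero + subsetSum (x ∘ suc) U
  subsetSum x (false ∷ U) = subsetSum (x ∘ suc) U

bound : ℕ → ℕ → ℕ
bound n k = sum (map (λ j → (n ∸ 1) C j) (upTo k)) +ℕ 1

module Submission where

-- Generalise the threshold 0 to any t ≥ 0 and count only NONEMPTY subsets U of an
-- (m+1)-set with sum ≥ t ("heavy" sets), assuming every subset of more than k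
-- elements has sum < t. Then at most B(m,k) = C(m,0) + … + C(m,k-1) sets are heavy;
-- the theorem is the case t = 0, the final "+ 1" accounting for the empty set.
-- The bound is proved by induction on m, for k ≤ m:
--   * k = 0: every nonempty set has more than k elements, so none is heavy;
--   * k = m: only the full set is assumed light; then no set is heavy together with
--     its complement, and pairing complements gives at most 2^m - 1 = B(m,m);
--   * otherwise take a minimal entry x i. If x i ≥ 0 all entries are nonnegative,
--     every subset sum is at most the (light) total, and nothing is heavy. If x i ≤ 0,
--     the heavy sets avoiding i are heavy for (k, t) on the other m entries, those
--     containing i are heavy for (k-1, t - x i) with t - x i ≥ 0, and Pascal's rule
--     B(m+1,k+1) = B(m,k+1) + B(m,k) adds the two inductive bounds.

open import Defs
open import Data.Nat using (ℕ; _∸_) renaming (_≤_ to _≤ℕ_; _<_ to _<ℕ_)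
open import Data.List using (List; length)
open import Data.List.Relation.Unary.All using (All)
open import Data.List.Relation.Unary.Unique.Propositional using (Unique)
open import Data.Fin using (Fin)
open import Data.Fin.Subset using (Subset; ∣_∣)


module BinomialSums where

  open import Data.Nat using (ℕ; zero; suc; _+_; _*_; _^_)
  open import Data.Nat.Properties using (+-identityʳ; +-comm; n<1+n)
  open import Data.Nat.Combinatorics using (_C_; nCk+nC[k+1]≡[n+1]C[k+1]; k>n⇒nCk≡0; nCn≡1)
  open import Data.Nat.Tactic.RingSolver using (solve-∀)
  open import Data.List using (map; upTo; [_]; _++_)
  open import Data.List.Properties using (applyUpTo-∷ʳ; map-++)
  open import Data.Nat.ListAction using (sum)
  open import Data.Nat.ListAction.Properties using (sum-++)
  open import Relation.Binary.PropositionalEquality using (_≡_; refl; sym; cong; cong₂; module ≡-Reasoning)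
  open ≡-Reasoning

  binomSum : ℕ → ℕ → ℕ
  binomSum m zero    = zero
  binomSum m (suc k) = binomSum m k + m C k

  sum-upTo≡binomSum : ∀ m k → sum (map (m C_) (upTo k)) ≡ binomSum m k
  sum-upTo≡binomSum m zero    = refl
  sum-upTo≡binomSum m (suc k) = begin
    sum (map (m C_) (upTo (suc k)))           ≡⟨ cong (λ l → sum (map (m C_) l)) (sym (applyUpTo-∷ʳ (λ j → j) k)) ⟩
    sum (map (m C_) (upTo k ++ [ k ]))        ≡⟨ cong sum (map-++ (m C_) (upTo k) [ k ]) ⟩
    sum (map (m C_) (upTo k) ++ [ m C k ])    ≡⟨ sum-++ (map (m C_) (upTo k)) [ m C k ] ⟩
    sum (map (m C_) (upTo k)) + (m C k + 0)   ≡⟨ cong₂ _+_ (sum-upTo≡binomSum m k) (+-identityʳ _) ⟩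
    binomSum m k + m C k                      ∎

  binomSum-pascal : ∀ m k → binomSum (suc m) (suc k) ≡ binomSum m (suc k) + binomSum m k
  binomSum-pascal m zero    = refl
  binomSum-pascal m (suc k) = begin
    binomSum (suc m) (suc k) + suc m C suc k
      ≡⟨ cong₂ _+_ (binomSum-pascal m k) (sym (nCk+nC[k+1]≡[n+1]C[k+1] m k)) ⟩
    (binomSum m (suc k) + binomSum m k) + (m C k + m C suc k)
      ≡⟨ shuffle (binomSum m (suc k)) (binomSum m k) (m C k) (m C suc k) ⟩
    (binomSum m (suc k) + m C suc k) + (binomSum m k + m C k) ∎
    where
      shuffle : ∀ a b c d → (a + b) + (c + d) ≡ (a + d) + (b + c)
      shuffle = solve-∀

  binomSum-all : ∀ m → binomSum m (suc m) ≡ 2 ^ m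
  binomSum-all zero    = refl
  binomSum-all (suc m) = begin
    binomSum (suc m) (suc (suc m))                       ≡⟨ binomSum-pascal m (suc m) ⟩
    (binomSum m (suc m) + m C suc m) + binomSum m (suc m)
      ≡⟨ cong (λ c → (binomSum m (suc m) + c) + binomSum m (suc m)) (k>n⇒nCk≡0 (n<1+n m)) ⟩
    (binomSum m (suc m) + 0) + binomSum m (suc m)
      ≡⟨ cong₂ (λ a b → (a + 0) + b) (binomSum-all m) (binomSum-all m) ⟩
    (2 ^ m + 0) + 2 ^ m                                  ≡⟨ doubling (2 ^ m) ⟩
    2 ^ suc m                                            ∎
    where
      doubling : ∀ a → (a + 0) + a ≡ 2 * a
      doubling = solve-∀

  -- Dropping the last coefficient C(m,m) = 1: 1 + binomSum m m = 2^m.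
  binomSum-diag : ∀ m → suc (binomSum m m) ≡ 2 ^ m
  binomSum-diag m = begin
    suc (binomSum m m)      ≡⟨ +-comm 1 (binomSum m m) ⟩
    binomSum m m + 1        ≡⟨ cong (binomSum m m +_) (sym (nCn≡1 m)) ⟩
    binomSum m (suc m)      ≡⟨ binomSum-all m ⟩
    2 ^ m                   ∎


module Subsets where

  import Data.Bool.Properties as Bool
  open import Data.Nat using (zero; suc; _+_; _≤_; _<_; _^_; s≤s; z≤n)
  open import Data.Nat.Properties using (+-suc; +-mono-≤; +-identityʳ; ≤-refl; module ≤-Reasoning)
  open import Data.Fin using (Fin; zero; suc)
  open import Data.Fin.Subset using (Subset; ⊥; ⊤; ∁; ∣_∣; inside; outside)
  open import Data.Vec using (insertAt; removeAt; lookup; _∷_; [])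
  open import Data.Vec.Properties using (insertAt-removeAt; ∷-injectiveˡ; ∷-injectiveʳ; ≡-dec)
  open import Data.List using (List; length; _++_; map; []; _∷_)
  open import Data.List.Properties using (length-++; length-map)
  open import Data.List.Relation.Unary.All as All using (All; []; _∷_)
  import Data.List.Relation.Unary.All.Properties as All
  open import Data.List.Relation.Unary.Any using (here; there)
  open import Data.List.Relation.Unary.AllPairs using ([]; _∷_)
  open import Data.List.Relation.Unary.Unique.Propositional using (Unique)
  open import Data.List.Relation.Unary.Unique.Propositional.Properties using (++⁺; map⁺)
  open import Data.List.Membership.Propositional using (_∈_)
  open import Data.List.Membership.Propositional.Properties using (∈-map⁻)
  open import Data.Empty renaming (⊥ to Empty) using (⊥-elim)
  open import Data.Product using (_×_; _,_; proj₂)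
  open import Relation.Nullary using (¬_; yes; no)
  open import Function using (_∘_)
  open import Relation.Binary.PropositionalEquality
    using (_≡_; _≢_; refl; sym; trans; cong; cong₂; subst)

  reinsert : ∀ {n} (U : Subset (suc n)) (i : Fin (suc n)) {b} →
    lookup U i ≡ b → insertAt (removeAt U i) i b ≡ U
  reinsert U i refl = insertAt-removeAt U i

  record Split {n} (i : Fin (suc n)) (Us : List (Subset (suc n))) : Set where
    field
      outs ins     : List (Subset n)
      length-split : length Us ≡ length outs + length ins
      outs-unique  : Unique outs
      ins-unique   : Unique ins
      outs-∈       : All (λ W → insertAt W i outside ∈ Us) outs
      ins-∈        : All (λ W → insertAt W i inside ∈ Us) ins

  removeAt-fresh : ∀ {n} (i : Fin (suc n)) {b} {U} {Us : List (Subset (suc n))} (L : List (Subset n)) →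
    All (U ≢_) Us → lookup U i ≡ b → All (λ W → insertAt W i b ∈ Us) L → All (removeAt U i ≢_) L
  removeAt-fresh i {U = U} L U∉Us Ui≡b L⊆Us = All.map
    (λ W∈Us U-i≡W → All.lookup U∉Us W∈Us
      (trans (sym (reinsert U i Ui≡b)) (cong (λ V → insertAt V i _) U-i≡W)))
    L⊆Us

  split : ∀ {n} (i : Fin (suc n)) (Us : List (Subset (suc n))) → Unique Us → Split i Us
  split i [] _ = record
    { outs = [] ; ins = [] ; length-split = refl ; outs-unique = [] ; ins-unique = []
    ; outs-∈ = [] ; ins-∈ = [] }
  split i (U ∷ Us) (U∉Us ∷ Us-unique) with split i Us Us-unique | lookup U i in Ui≡b
  ... | s | outside = record
    { outs         = removeAt U i ∷ outs
    ; ins          = ins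
    ; length-split = cong suc length-split
    ; outs-unique  = removeAt-fresh i outs U∉Us Ui≡b outs-∈ ∷ outs-unique
    ; ins-unique   = ins-unique
    ; outs-∈       = here (reinsert U i Ui≡b) ∷ All.map there outs-∈
    ; ins-∈        = All.map there ins-∈ }
    where open Split s
  ... | s | inside = record
    { outs         = outs
    ; ins          = removeAt U i ∷ ins
    ; length-split = trans (cong suc length-split) (sym (+-suc (length outs) (length ins)))
    ; outs-unique  = outs-unique
    ; ins-unique   = removeAt-fresh i ins U∉Us Ui≡b ins-∈ ∷ ins-unique
    ; outs-∈       = All.map there outs-∈
    ; ins-∈        = here (reinsert U i Ui≡b) ∷ All.map there ins-∈ }
    where open Split s

  unique-length≤2^ : ∀ m (Us : List (Subset m)) → Unique Us → length Us ≤ 2 ^ m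
  unique-length≤2^ zero []                  _                 = z≤n
  unique-length≤2^ zero ([] ∷ [])           _                 = s≤s z≤n
  unique-length≤2^ zero ([] ∷ [] ∷ _)       (([]≢[] ∷ _) ∷ _) = ⊥-elim ([]≢[] refl)
  unique-length≤2^ (suc m) Us Us-unique = begin
    length Us                  ≡⟨ length-split ⟩
    length outs + length ins   ≤⟨ +-mono-≤ (unique-length≤2^ m outs outs-unique)
                                           (unique-length≤2^ m ins ins-unique) ⟩
    2 ^ m + 2 ^ m              ≡⟨ cong (2 ^ m +_) (sym (+-identityʳ _)) ⟩
    2 ^ suc m                  ∎
    where
      open Split (split zero Us Us-unique)
      open ≤-Reasoning

  ∁-injective : ∀ {m} {V W : Subset m} → ∁ V ≡ ∁ W → V ≡ W
  ∁-injective {V = []}    {[]}    _ = refl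
  ∁-injective {V = _ ∷ _} {_ ∷ _} e =
    cong₂ _∷_ (Bool.not-injective (∷-injectiveˡ e)) (∁-injective (∷-injectiveʳ e))

  ∁≡⊥⇒≡⊤ : ∀ {m} (V : Subset m) → ∁ V ≡ ⊥ → V ≡ ⊤
  ∁≡⊥⇒≡⊤ []          _ = refl
  ∁≡⊥⇒≡⊤ (inside ∷ V) e = cong (inside ∷_) (∁≡⊥⇒≡⊤ V (∷-injectiveʳ e))
  ∁≡⊥⇒≡⊤ (outside ∷ V) ()

  -- A duplicate-free family of proper nonempty subsets of an (m+1)-set that never
  -- contains a set together with its complement has fewer than 2^m members: delete
  -- the point 0 from every member, complementing those that contained it; this
  -- gives distinct nonempty subsets of the remaining m points.
  complementFree-length : ∀ m (Us : List (Subset (suc m))) → Unique Us →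
    All (_≢ ⊥) Us → All (_≢ ⊤) Us → (∀ {U} → U ∈ Us → ∁ U ∈ Us → Empty) →
    suc (length Us) ≤ 2 ^ m
  complementFree-length m Us Us-unique ≢⊥ ≢⊤ noPair =
    subst (λ l → suc l ≤ 2 ^ m) length-folded
      (unique-length≤2^ m (⊥ ∷ folded) (All.map (λ ≢⊥ e → ≢⊥ (sym e)) folded-≢⊥ ∷ folded-unique))
    where
      open Split (split zero Us Us-unique)
      folded = outs ++ map ∁ ins
      disjoint : ∀ {W} → ¬ (W ∈ outs × W ∈ map ∁ ins)
      disjoint (W∈outs , W∈∁ins) with ∈-map⁻ ∁ W∈∁ins
      ... | V , V∈ins , refl = noPair (All.lookup ins-∈ V∈ins) (All.lookup outs-∈ W∈outs)
      folded-unique : Unique folded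
      folded-unique = ++⁺ outs-unique (map⁺ ∁-injective ins-unique) disjoint
      folded-≢⊥ : All (_≢ ⊥) folded
      folded-≢⊥ = All.++⁺
        (All.map (λ W∈Us W≡⊥ → All.lookup ≢⊥ W∈Us (cong (outside ∷_) W≡⊥)) outs-∈)
        (All.map⁺ (All.map (λ V∈Us ∁V≡⊥ → All.lookup ≢⊤ V∈Us (cong (inside ∷_) (∁≡⊥⇒≡⊤ _ ∁V≡⊥))) ins-∈))
      length-folded : length folded ≡ length Us
      length-folded = trans (length-++ outs) (trans (cong (length outs +_) (length-map ∁ ins)) (sym length-split))

  record WithoutEmpty {n} (Us : List (Subset n)) : Set where
    field
      nonempties        : List (Subset n)
      nonempties-unique : Unique nonempties
      nonempties-⊆      : All (λ V → V ≢ ⊥ × V ∈ Us) nonempties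
      length-≤          : length Us ≤ suc (length nonempties)

  removeEmpty : ∀ {n} (Us : List (Subset n)) → Unique Us → WithoutEmpty Us
  removeEmpty [] _ = record
    { nonempties = [] ; nonempties-unique = [] ; nonempties-⊆ = [] ; length-≤ = z≤n }
  removeEmpty (U ∷ Us) (U∉Us ∷ Us-unique) with ≡-dec Bool._≟_ U ⊥
  ... | yes refl = record
    { nonempties        = Us
    ; nonempties-unique = Us-unique
    ; nonempties-⊆      = All.tabulate (λ V∈Us → (λ V≡⊥ → All.lookup U∉Us V∈Us (sym V≡⊥)) , there V∈Us)
    ; length-≤          = ≤-refl }
  ... | no U≢⊥ = record
    { nonempties        = U ∷ nonempties
    ; nonempties-unique = All.map (λ V∈ U≡V → All.lookup U∉Us (proj₂ V∈) U≡V) nonempties-⊆ ∷ nonempties-unique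
    ; nonempties-⊆      = (U≢⊥ , here refl) ∷ All.map (λ (V≢⊥ , V∈Us) → V≢⊥ , there V∈Us) nonempties-⊆
    ; length-≤          = s≤s length-≤ }
    where open WithoutEmpty (removeEmpty Us Us-unique)

  ∣insertAt-inside∣ : ∀ {n} (W : Subset n) i → ∣ insertAt W i inside ∣ ≡ suc ∣ W ∣
  ∣insertAt-inside∣ W             zero    = refl
  ∣insertAt-inside∣ (inside ∷ W)  (suc i) = cong suc (∣insertAt-inside∣ W i)
  ∣insertAt-inside∣ (outside ∷ W) (suc i) = ∣insertAt-inside∣ W i

  ∣insertAt-outside∣ : ∀ {n} (W : Subset n) i → ∣ insertAt W i outside ∣ ≡ ∣ W ∣
  ∣insertAt-outside∣ W             zero    = refl
  ∣insertAt-outside∣ (inside ∷ W)  (suc i) = cong suc (∣insertAt-outside∣ W i)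
  ∣insertAt-outside∣ (outside ∷ W) (suc i) = ∣insertAt-outside∣ W i

  insertAt-⊥ : ∀ {n} (i : Fin (suc n)) → insertAt ⊥ i outside ≡ ⊥
  insertAt-⊥         zero    = refl
  insertAt-⊥ {suc n} (suc i) = cong (outside ∷_) (insertAt-⊥ i)

  ≢⊥⇒∣∣>0 : ∀ {n} (U : Subset n) → U ≢ ⊥ → 0 < ∣ U ∣
  ≢⊥⇒∣∣>0 []            U≢⊥ = ⊥-elim (U≢⊥ refl)
  ≢⊥⇒∣∣>0 (inside ∷ U)  U≢⊥ = s≤s z≤n
  ≢⊥⇒∣∣>0 (outside ∷ U) U≢⊥ = ≢⊥⇒∣∣>0 U (U≢⊥ ∘ cong (outside ∷_))

module OrderedFieldFacts {c ℓ₁ ℓ₂} (F : OrderedField c ℓ₁ ℓ₂) where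

  open import Data.Nat using (zero; suc)
  open import Data.Fin using (Fin; zero; suc; punchIn)
  open import Data.Fin.Subset using (⊥; ⊤; ∁; inside; outside)
  open import Data.Vec using (insertAt; _∷_; [])
  open import Data.Product using (Σ; _,_)
  open import Data.Sum using (inj₁; inj₂)
  open import Relation.Nullary using (¬_)
  open import Relation.Binary.Bundles using (Poset)
  import Relation.Binary.Reasoning.PartialOrder as PartialOrderReasoning
  open import Relation.Binary.Structures using (IsTotalOrder)
  open import Function using (_∘_)
  open import Algebra.Bundles using (CommutativeRing)

  open OrderedField F
  module R = CommutativeRing commRing
  open R using (-_; _-_)
  module O = IsTotalOrder isTotalOrder
  open import Algebra.Properties.AbelianGroup R.+-abelianGroup using (xyx⁻¹≈y; ∙-cancelʳ)

  poset : Poset c ℓ₁ ℓ₂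
  poset = record { isPartialOrder = IsTotalOrder.isPartialOrder isTotalOrder }
  module ≤-Reasoning = PartialOrderReasoning poset
  open ≤-Reasoning

  ≤⇒≯ : ∀ {a b} → a ≤ b → ¬ (b < a)
  ≤⇒≯ a≤b (b≤a , b≉a) = b≉a (O.antisym b≤a a≤b)

  <-respˡ-≈ : ∀ {a b d} → a ≈ b → a < d → b < d
  <-respˡ-≈ a≈b (a≤d , a≉d) = (begin _ ≈⟨ R.sym a≈b ⟩ _ ≤⟨ a≤d ⟩ _ ∎) , λ b≈d → a≉d (R.trans a≈b b≈d)

  +-monoˡ-≤ : ∀ {a b} d → a ≤ b → (d + a) ≤ (d + b)
  +-monoˡ-≤ {a} {b} d a≤b = begin
    d + a ≈⟨ R.+-comm d a ⟩
    a + d ≤⟨ +-mono-≤ d a≤b ⟩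
    b + d ≈⟨ R.+-comm b d ⟩
    d + b ∎

  +-mono-< : ∀ {a b} d → a < b → (a + d) < (b + d)
  +-mono-< d (a≤b , a≉b) = +-mono-≤ d a≤b , λ a+d≈b+d → a≉b (∙-cancelʳ d _ _ a+d≈b+d)

  x≤y+x : ∀ {x y} → 0# ≤ y → x ≤ (y + x)
  x≤y+x {x} {y} 0≤y = begin
    x      ≈⟨ R.sym (R.+-identityˡ x) ⟩
    0# + x ≤⟨ +-mono-≤ x 0≤y ⟩
    y + x  ∎

  ≤-shift : ∀ {a s t} → t ≤ (a + s) → (t - a) ≤ s
  ≤-shift {a} {s} {t} t≤a+s = begin
    t - a       ≤⟨ +-mono-≤ (- a) t≤a+s ⟩
    a + s - a   ≈⟨ xyx⁻¹≈y a s ⟩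
    s           ∎

  <-shift : ∀ {a s t} → (a + s) < t → s < (t - a)
  <-shift {a} {s} a+s<t = <-respˡ-≈ (xyx⁻¹≈y a s) (+-mono-< (- a) a+s<t)

  nonneg-nonpos : ∀ {a t} → 0# ≤ t → a ≤ 0# → 0# ≤ (t - a)
  nonneg-nonpos {a} {t} 0≤t a≤0 = begin
    0#       ≈⟨ R.sym (R.-‿inverseʳ a) ⟩
    a - a    ≤⟨ +-mono-≤ (- a) a≤0 ⟩
    0# - a   ≤⟨ +-mono-≤ (- a) 0≤t ⟩
    t - a    ∎

  minimumIndex : ∀ {n} (x : Fin (suc n) → Carrier) → Σ (Fin (suc n)) λ i → ∀ j → x i ≤ x j
  minimumIndex {zero} x = zero , λ { zero → O.refl }
  minimumIndex {suc n} x with minimumIndex (x ∘ suc)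
  ... | i , min with O.total (x zero) (x (suc i))
  ...   | inj₁ x₀≤xᵢ = zero , λ { zero → O.refl ; (suc j) → O.trans x₀≤xᵢ (min j) }
  ...   | inj₂ xᵢ≤x₀ = suc i , λ { zero → xᵢ≤x₀ ; (suc j) → min j }

  subsetSum-⊥ : ∀ {n} (x : Fin n → Carrier) → subsetSum x ⊥ ≈ 0#
  subsetSum-⊥ {zero}  x = R.refl
  subsetSum-⊥ {suc n} x = subsetSum-⊥ (x ∘ suc)

  subsetSum-≤-⊤ : ∀ {n} (x : Fin n → Carrier) → (∀ i → 0# ≤ x i) → ∀ U → subsetSum x U ≤ subsetSum x ⊤
  subsetSum-≤-⊤ x x≥0 []            = O.refl
  subsetSum-≤-⊤ x x≥0 (inside ∷ U)  = +-monoˡ-≤ (x zero) (subsetSum-≤-⊤ (x ∘ suc) (x≥0 ∘ suc) U)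
  subsetSum-≤-⊤ x x≥0 (outside ∷ U) = O.trans (subsetSum-≤-⊤ (x ∘ suc) (x≥0 ∘ suc) U) (x≤y+x (x≥0 zero))

  subsetSum-∁ : ∀ {n} (x : Fin n → Carrier) U → (subsetSum x U + subsetSum x (∁ U)) ≈ subsetSum x ⊤
  subsetSum-∁ x [] = R.+-identityʳ 0#
  subsetSum-∁ x (inside ∷ U) = begin-equality
    (x zero + a) + b  ≈⟨ R.+-assoc _ _ _ ⟩
    x zero + (a + b)  ≈⟨ R.+-cong R.refl (subsetSum-∁ (x ∘ suc) U) ⟩
    x zero + subsetSum (x ∘ suc) ⊤ ∎
    where a = subsetSum (x ∘ suc) U
          b = subsetSum (x ∘ suc) (∁ U)
  subsetSum-∁ x (outside ∷ U) = begin-equality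
    a + (x zero + b)  ≈⟨ R.sym (R.+-assoc _ _ _) ⟩
    (a + x zero) + b  ≈⟨ R.+-cong (R.+-comm _ _) R.refl ⟩
    (x zero + a) + b  ≈⟨ R.+-assoc _ _ _ ⟩
    x zero + (a + b)  ≈⟨ R.+-cong R.refl (subsetSum-∁ (x ∘ suc) U) ⟩
    x zero + subsetSum (x ∘ suc) ⊤ ∎
    where a = subsetSum (x ∘ suc) U
          b = subsetSum (x ∘ suc) (∁ U)

  subsetSum-insertAt-inside : ∀ {n} (x : Fin (suc n) → Carrier) W i →
    subsetSum x (insertAt W i inside) ≈ (x i + subsetSum (x ∘ punchIn i) W)
  subsetSum-insertAt-inside x W zero = R.refl
  subsetSum-insertAt-inside x (inside ∷ W) (suc i) = begin-equality
    x zero + subsetSum (x ∘ suc) (insertAt W i inside)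
      ≈⟨ R.+-cong R.refl (subsetSum-insertAt-inside (x ∘ suc) W i) ⟩
    x zero + (x (suc i) + s)  ≈⟨ R.sym (R.+-assoc _ _ _) ⟩
    (x zero + x (suc i)) + s  ≈⟨ R.+-cong (R.+-comm _ _) R.refl ⟩
    (x (suc i) + x zero) + s  ≈⟨ R.+-assoc _ _ _ ⟩
    x (suc i) + (x zero + s)  ∎
    where s = subsetSum (x ∘ suc ∘ punchIn i) W
  subsetSum-insertAt-inside x (outside ∷ W) (suc i) = subsetSum-insertAt-inside (x ∘ suc) W i

  subsetSum-insertAt-outside : ∀ {n} (x : Fin (suc n) → Carrier) W i →
    subsetSum x (insertAt W i outside) ≈ subsetSum (x ∘ punchIn i) W
  subsetSum-insertAt-outside x W zero = R.refl
  subsetSum-insertAt-outside x (inside ∷ W) (suc i) = R.+-cong R.refl (subsetSum-insertAt-outside (x ∘ suc) W i)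
  subsetSum-insertAt-outside x (outside ∷ W) (suc i) = subsetSum-insertAt-outside (x ∘ suc) W i

module Counting {c ℓ₁ ℓ₂} (F : OrderedField c ℓ₁ ℓ₂) where

  open import Data.Nat using (zero; suc; z≤n; s≤s)
  import Data.Nat.Properties as ℕₚ
  open import Data.Fin using (punchIn)
  open import Data.Fin.Subset using (⊥; ⊤; ∁; inside; outside)
  open import Data.Fin.Subset.Properties using (∣⊤∣≡n)
  open import Data.Vec using (insertAt)
  open import Data.List.Relation.Unary.All as All using ([]; _∷_)
  open import Data.List.Membership.Propositional using (_∈_)
  open import Data.Product using (_×_; _,_; proj₁; proj₂)
  open import Data.Sum using (inj₁; inj₂)
  open import Data.Empty renaming (⊥ to Empty) using (⊥-elim)
  open import Relation.Nullary using (¬_)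
  open import Relation.Binary.PropositionalEquality using (_≢_; refl; sym; trans; cong; subst; subst₂)
  open import Function using (_∘_)

  open OrderedField F
  open OrderedFieldFacts F
  open R using (_-_)
  open BinomialSums
  open Subsets

  Heavy : ∀ {n} → (Fin n → Carrier) → Carrier → Subset n → Set _
  Heavy x t U = (U ≢ ⊥) × (t ≤ subsetSum x U)

  LightAbove : ∀ {n} → ℕ → (Fin n → Carrier) → Carrier → Set _
  LightAbove k x t = ∀ U → k <ℕ ∣ U ∣ → subsetSum x U < t

  HeavyBound : ℕ → ℕ → Set _
  HeavyBound m k = ∀ (x : Fin (suc m) → Carrier) t → 0# ≤ t → LightAbove k x t →
    ∀ Us → Unique Us → All (Heavy x t) Us → length Us ≤ℕ binomSum m k

  noneHeavy : ∀ {n} {x : Fin n → Carrier} {t} {Us} b → (∀ U → ¬ Heavy x t U) →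
    All (Heavy x t) Us → length Us ≤ℕ b
  noneHeavy b ¬heavy []      = z≤n
  noneHeavy b ¬heavy (h ∷ _) = ⊥-elim (¬heavy _ h)

  ⊤-light : ∀ {m k} {x : Fin (suc m) → Carrier} {t} → k ≤ℕ m → LightAbove k x t → subsetSum x ⊤ < t
  ⊤-light {m} {k} k≤m light = light ⊤ (subst (k <ℕ_) (sym (∣⊤∣≡n (suc m))) (s≤s k≤m))

  nonneg⇒¬heavy : ∀ {n} {x : Fin n → Carrier} {t} → (∀ i → 0# ≤ x i) → subsetSum x ⊤ < t →
    ∀ U → ¬ Heavy x t U
  nonneg⇒¬heavy {x = x} x≥0 total<t U (_ , t≤ΣU) = ≤⇒≯ (O.trans t≤ΣU (subsetSum-≤-⊤ x x≥0 U)) total<t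

  heavyBound-zero : ∀ m → HeavyBound m 0
  heavyBound-zero m x t _ light Us _ heavy =
    noneHeavy (binomSum m 0) (λ U (U≢⊥ , t≤ΣU) → ≤⇒≯ t≤ΣU (light U (≢⊥⇒∣∣>0 U U≢⊥))) heavy

  -- k = m: only the full set is assumed light. It is not heavy, and neither is any set
  -- together with its complement (their sums would add up to the total, which is < t),
  -- which leaves at most 2^m - 1 = binomSum m m heavy sets.
  heavyBound-top : ∀ m → HeavyBound m m
  heavyBound-top m x t 0≤t light Us Us-unique heavy =
    ℕₚ.≤-pred (subst (suc (length Us) ≤ℕ_) (sym (binomSum-diag m))
      (complementFree-length m Us Us-unique (All.map proj₁ heavy) (All.map heavy⇒≢⊤ heavy) noPair))
    where
      total<t : subsetSum x ⊤ < t
      total<t = ⊤-light ℕₚ.≤-refl light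
      heavy⇒≢⊤ : ∀ {U} → Heavy x t U → U ≢ ⊤
      heavy⇒≢⊤ (_ , t≤ΣU) refl = ≤⇒≯ t≤ΣU total<t
      noPair : ∀ {U} → U ∈ Us → ∁ U ∈ Us → Empty
      noPair {U} U∈Us ∁U∈Us = ≤⇒≯ t≤total total<t
        where
          open ≤-Reasoning
          t≤total : t ≤ subsetSum x ⊤
          t≤total = begin
            t                                    ≤⟨ proj₂ (All.lookup heavy U∈Us) ⟩
            subsetSum x U                        ≤⟨ x≤y+x (O.trans 0≤t (proj₂ (All.lookup heavy ∁U∈Us))) ⟩
            subsetSum x (∁ U) + subsetSum x U    ≈⟨ R.+-comm _ _ ⟩
            subsetSum x U + subsetSum x (∁ U)    ≈⟨ subsetSum-∁ x U ⟩
            subsetSum x ⊤                        ∎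

  -- 0 < k+1 ≤ m+1: split at a minimal entry x i. If x i ≥ 0 nothing is heavy.
  -- Otherwise the heavy sets avoiding i are heavy for the remaining entries with the
  -- same threshold t and size bound k+1, those containing i are heavy for threshold
  -- t - x i ≥ 0 and size bound k; Pascal's rule adds the two bounds.
  heavyBound-step : ∀ m k → k ≤ℕ m → HeavyBound m k → HeavyBound m (suc k) → HeavyBound (suc m) (suc k)
  heavyBound-step m k k≤m boundₖ boundₖ₊₁ x t 0≤t light Us Us-unique heavy with minimumIndex x
  ... | i , minimal with O.total 0# (x i)
  ...   | inj₁ 0≤xᵢ = noneHeavy _ (nonneg⇒¬heavy (λ j → O.trans 0≤xᵢ (minimal j)) (⊤-light (s≤s k≤m) light)) heavy
  ...   | inj₂ xᵢ≤0 = subst₂ _≤ℕ_ (sym length-split) (sym (binomSum-pascal m k)) (ℕₚ.+-mono-≤ outs-bound ins-bound)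
    where
      open Split (split i Us Us-unique)
      x′ : Fin (suc m) → Carrier
      x′ = x ∘ punchIn i

      light₀ : LightAbove (suc k) x′ t
      light₀ W k<∣W∣ = <-respˡ-≈ (subsetSum-insertAt-outside x W i)
        (light (insertAt W i outside) (subst (suc k <ℕ_) (sym (∣insertAt-outside∣ W i)) k<∣W∣))

      heavy₀ : ∀ {W} → insertAt W i outside ∈ Us → Heavy x′ t W
      heavy₀ {W} W∈Us with All.lookup heavy W∈Us
      ... | W≢⊥ , t≤ΣW = (λ W≡⊥ → W≢⊥ (trans (cong (λ V → insertAt V i outside) W≡⊥) (insertAt-⊥ i)))
                       , O.≲-respʳ-≈ (subsetSum-insertAt-outside x W i) t≤ΣW

      outs-bound : length outs ≤ℕ binomSum m (suc k)
      outs-bound = boundₖ₊₁ x′ t 0≤t light₀ outs outs-unique (All.map heavy₀ outs-∈)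

      light₁ : LightAbove k x′ (t - x i)
      light₁ W k<∣W∣ = <-shift (<-respˡ-≈ (subsetSum-insertAt-inside x W i)
        (light (insertAt W i inside) (subst (suc k <ℕ_) (sym (∣insertAt-inside∣ W i)) (s≤s k<∣W∣))))

      -- W = ∅ is impossible: {i} heavy means 0 ≤ t ≤ x i, making every entry nonnegative.
      heavy₁ : ∀ {W} → insertAt W i inside ∈ Us → Heavy x′ (t - x i) W
      heavy₁ {W} W∈Us with All.lookup heavy W∈Us
      ... | h@(_ , t≤ΣW) = notSingleton , ≤-shift t≤xᵢ+ΣW
        where
          t≤xᵢ+ΣW : t ≤ (x i + subsetSum x′ W)
          t≤xᵢ+ΣW = O.≲-respʳ-≈ (subsetSum-insertAt-inside x W i) t≤ΣW
          notSingleton : W ≢ ⊥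
          notSingleton refl = nonneg⇒¬heavy (λ j → O.trans 0≤xᵢ (minimal j)) (⊤-light (s≤s k≤m) light) _ h
            where
              0≤xᵢ : 0# ≤ x i
              0≤xᵢ = O.trans 0≤t (O.≲-respʳ-≈ (R.trans (R.+-cong R.refl (subsetSum-⊥ x′)) (R.+-identityʳ _)) t≤xᵢ+ΣW)

      ins-bound : length ins ≤ℕ binomSum m k
      ins-bound = boundₖ x′ (t - x i) (nonneg-nonpos 0≤t xᵢ≤0) light₁ ins ins-unique (All.map heavy₁ ins-∈)

  heavyBound : ∀ m k → k ≤ℕ m → HeavyBound m k
  heavyBound m k k≤m with ℕₚ.m≤n⇒m<n∨m≡n k≤m
  ... | inj₂ refl = heavyBound-top m
  heavyBound m       zero    _ | inj₁ _        = heavyBound-zero m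
  heavyBound (suc m) (suc k) _ | inj₁ (s≤s k<m) =
    heavyBound-step m k (ℕₚ.<⇒≤ k<m) (heavyBound m k (ℕₚ.<⇒≤ k<m)) (heavyBound m (suc k) k<m)

open import Data.Nat using (zero; suc; s≤s; _+_)
import Data.Nat.Properties as ℕₚ
open import Data.Product using (_,_)
open import Relation.Binary.PropositionalEquality using (sym; cong)
open import Relation.Binary.Structures using (IsTotalOrder)
import Data.List.Relation.Unary.All as All
open BinomialSums using (binomSum; sum-upTo≡binomSum)
open Subsets using (removeEmpty; module WithoutEmpty)

theorem1p1 : ∀ {c ℓ₁ ℓ₂} (F : OrderedField c ℓ₁ ℓ₂) → let open OrderedField F in
    (n k : ℕ) → 1 ≤ℕ k → k ≤ℕ n ∸ 1 → (x : Fin n → Carrier) →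
    (∀ (U : Subset n) → k <ℕ ∣ U ∣ → subsetSum x U < 0#) →
    (Us : List (Subset n)) → Unique Us → All (λ U → 0# ≤ subsetSum x U) Us →
    length Us ≤ℕ bound n k
theorem1p1 F zero    (suc k) _ () x light Us Us-unique nonneg
theorem1p1 F (suc m) k       _ k≤m x light Us Us-unique nonneg = begin
  length Us                  ≤⟨ length-≤ ⟩
  suc (length nonempties)    ≤⟨ s≤s nonempties-bound ⟩
  suc (binomSum m k)         ≡⟨ ℕₚ.+-comm 1 (binomSum m k) ⟩
  binomSum m k + 1           ≡⟨ cong (_+ 1) (sym (sum-upTo≡binomSum m k)) ⟩
  bound (suc m) k            ∎
  where
    open ℕₚ.≤-Reasoning
    open OrderedField F using (0#; isTotalOrder)
    open WithoutEmpty (removeEmpty Us Us-unique)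
    nonempties-bound : length nonempties ≤ℕ binomSum m k
    nonempties-bound = Counting.heavyBound F m k k≤m x 0# (IsTotalOrder.refl isTotalOrder) light
      nonempties nonempties-unique (All.map (λ (V≢⊥ , V∈Us) → V≢⊥ , All.lookup nonneg V∈Us) nonempties-⊆)
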